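{- For any $n\geq 1$, the ordering of chains $\Lambda_n$ is a 3-Gray code, i.e., any two consecutive chains in $\Lambda_n$, viewed as strings over the alphabet $\{0,1,*\}$, differ in at most three positions.
   Context: Let $D$ be the set of bitstrings (including the empty string $\varepsilon$) with equally many 0s and 1s such that every prefix has at least as many 0s as 1s. A (Greene–Kleitman) chain of $Q_n$ is a string $C=u_0*u_1*\cdots*u_h$ of length $n$ over $\{0,1,*\}$ with $u_0,\ldots,u_h\in D$; its length $|C|=h$ is the number of $*$s. For a chain $C$ with $|C|\ge 2$, $f(C)$ (resp. $\ell(C)$) is the chain obtained by replacing the first two (resp. last two) $*$s of $C$ by $0$ and $1$, respectively. For a string $C$, ${*}C{*}$ denotes $C$ with a $*$ prepended and appended, and $0C1$ denotes $C$ with $0$ prepended and $1$ appended. For a sequence $\Gamma$, $\Gamma^R$ denotes its reversal. The sequences $\Lambda_n$ are defined recursively. For even $n$: $\Lambda_0:=\varepsilon$ (the single chain of length $0$ in $Q_0$), and for even $n\ge 0$, if $\Lambda_n=C_1,\ldots,C_N$ then $\Lambda_{n+2}:=\rho(C_1),\ldots,\rho(C_N)$ (concatenation), where $\rho(C):=\lambda(C)$ if $|C|\equiv n \pmod 4$ and $\rho(C):=\lambda(C)^R$ otherwise, and $\lambda(C):={*}C{*},\,f({*}C{*}),\,f(\ell({*}C{*})),\,\ell({*}C{*})$ if $|C|\ge 2$, and $\lambda(C):={*}C{*},\,0C1$ if $|C|=0$. For odd $n$: $\Lambda_1:={*}$, and for odd $n\ge 1$, $\Lambda_{n+2}:=\rho(C_1),\ldots,\rho(C_N)$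 with $\rho$ as before, but with $\lambda(C):={*}C{*},\,\ell({*}C{*}),\,\ell(f({*}C{*})),\,f({*}C{*})$ if $|C|\ge 3$, and $\lambda(C):={*}C{*},\,\ell({*}C{*}),\,f({*}C{*})$ if $|C|=1$. -}

module Defs where

open import Data.Nat using (ℕ; zero; suc; _+_; _%_; _≡ᵇ_)
open import Data.Bool using (Bool; true; false; if_then_else_)
open import Data.List using (List; []; _∷_; [_]; _++_; reverse; concatMap)

data Sym : Set where
  O I S : Sym   -- O = 0, I = 1, S = *

Chain : Set
Chain = List Sym

-- number of *s (the length |C| of a chain)
stars : Chain → ℕ
stars []       = 0
stars (S ∷ c)  = suc (stars c)
stars (_ ∷ c)  = stars c

replaceFirstTwo : Sym → Sym → Chain → Chain
replaceFirstTwo a b []      = []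
replaceFirstTwo a b (S ∷ c) = a ∷ replaceSecond c
  where
  replaceSecond : Chain → Chain
  replaceSecond []      = []
  replaceSecond (S ∷ d) = b ∷ d
  replaceSecond (x ∷ d) = x ∷ replaceSecond d
replaceFirstTwo a b (x ∷ c) = x ∷ replaceFirstTwo a b c

f : Chain → Chain
f = replaceFirstTwo O I

-- ℓ(C): last two *s replaced by 0 and 1 (the earlier one by 0, the later by 1)
ℓ : Chain → Chain
ℓ c = reverse (replaceFirstTwo I O (reverse c))

wrapS : Chain → Chain
wrapS c = S ∷ (c ++ [ S ])

wrap01 : Chain → Chain
wrap01 c = O ∷ (c ++ [ I ])

isEven : ℕ → Bool
isEven zero          = true
isEven (suc zero)    = false
isEven (suc (suc n)) = isEven n

lamEven : Chain → List Chain
lamEven c with stars c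
... | zero  = wrapS c ∷ wrap01 c ∷ []
... | suc _ = wrapS c ∷ f (wrapS c) ∷ f (ℓ (wrapS c)) ∷ ℓ (wrapS c) ∷ []

lamOdd : Chain → List Chain
lamOdd c with stars c
... | suc zero = wrapS c ∷ ℓ (wrapS c) ∷ f (wrapS c) ∷ []
... | _        = wrapS c ∷ ℓ (wrapS c) ∷ ℓ (f (wrapS c)) ∷ f (wrapS c) ∷ []

lam : ℕ → Chain → List Chain
lam n c = if isEven n then lamEven c else lamOdd c

ρ : ℕ → Chain → List Chain
ρ n c = if (stars c % 4) ≡ᵇ (n % 4) then lam n c else reverse (lam n c)

Λ : ℕ → List Chain
Λ zero                = [] ∷ []
Λ (suc zero)          = (S ∷ []) ∷ []
Λ (suc (suc n))       = concatMap (ρ n) (Λ n)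

-- number of positions in which two strings differ
-- (positions present in only one string count as differing)
symEq : Sym → Sym → Bool
symEq O O = true
symEq I I = true
symEq S S = true
symEq _ _ = false

hamming : Chain → Chain → ℕ
hamming []       []       = 0
hamming []       (_ ∷ ys) = suc (hamming [] ys)
hamming (_ ∷ xs) []       = suc (hamming xs [])
hamming (x ∷ xs) (y ∷ ys) = (if symEq x y then 0 else 1) + hamming xs ys

-- The chains of a block arise from *C* by filling
-- at most two stars of C and changing the outer symbols, and consecutive ones differ in at most three
-- places. Whether ρ reads λ forwards depends only on |C| mod 4, which makes the last chain P of each
-- block read backwards and the first chain Q of the next block read forwards one level later; there
-- the two blocks meet in *P* and *Q*, at the distance of P and Q. So the induction carries, for
-- neighbours x, y of Λ n, the distance of x and y together with that of the chains meeting at the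
-- seam of ρ n x and ρ n y; inside a block the latter is an explicit estimate on the ends of λ.

module Submission where

open import Defs
open import Data.Nat using (ℕ; zero; suc; _+_; _%_; _≤_; _≤ᵇ_; _≡ᵇ_; z≤n; s≤s)
open import Data.Nat.DivMod using ([m+n]%n≡m%n)
open import Data.Nat.Properties using (+-comm; +-assoc; +-identityʳ; ≤-refl; ≤-reflexive; ≤-trans; +-monoʳ-≤; +-monoˡ-≤; suc-injective; ≤ᵇ⇒≤)
open import Data.Bool using (Bool; true; false; not; if_then_else_; T)
open import Data.List using (List; []; _∷_; [_]; _++_; reverse; length; head; last; concatMap)
open import Data.Maybe using (Maybe; just)
open import Data.List.Properties using (∷-injectiveʳ; ++-identityʳ; length-++; unfold-reverse; reverse-++; reverse-involutive)
open import Data.Product using (Σ; _×_; _,_; proj₁; proj₂)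
open import Data.List.Relation.Unary.All using (All; []; _∷_)
import Data.List.Relation.Unary.All.Properties as All
open import Data.List.Relation.Unary.Linked using (Linked; []; [-]; _∷_)
import Data.List.Relation.Unary.Linked as Linked
import Data.List.Relation.Unary.Linked.Properties as Linked
open import Data.Maybe.Relation.Binary.Connected using (Connected; just)
import Data.Maybe.Relation.Binary.Connected as Connected
open import Function using (_$_)
open import Relation.Binary.PropositionalEquality hiding ([_])

orient : ∀ {A : Set} → Bool → List A → List A
orient true  xs = xs
orient false xs = reverse xs

last-∷ʳ : ∀ {A : Set} (xs : List A) x → last (xs ++ [ x ]) ≡ just x
last-∷ʳ []           x = refl
last-∷ʳ (y ∷ [])     x = refl
last-∷ʳ (y ∷ z ∷ xs) x = last-∷ʳ (z ∷ xs) x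

last-reverse : ∀ {A : Set} (xs : List A) → last (reverse xs) ≡ head xs
last-reverse []       = refl
last-reverse (x ∷ xs) = trans (cong last (unfold-reverse x xs)) (last-∷ʳ (reverse xs) x)

head-reverse : ∀ {A : Set} (xs : List A) → head (reverse xs) ≡ last xs
head-reverse xs = begin
  head (reverse xs)                    ≡⟨ last-reverse (reverse xs) ⟨
  last (reverse (reverse xs))          ≡⟨ cong last (reverse-involutive xs) ⟩
  last xs                              ∎
  where open ≡-Reasoning

head-++ : ∀ {A : Set} (xs ys : List A) {h} → head xs ≡ just h → head (xs ++ ys) ≡ head xs
head-++ (x ∷ xs) ys _ = refl

All-reverse : ∀ {A : Set} {P : A → Set} {xs} → All P xs → All P (reverse xs)
All-reverse {xs = []}     []         = []
All-reverse {xs = x ∷ xs} (px ∷ pxs) rewrite unfold-reverse x xs = All.++⁺ (All-reverse pxs) (px ∷ [])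

All-orient : ∀ {A : Set} {P : A → Set} b {xs} → All P xs → All P (orient b xs)
All-orient true  ps = ps
All-orient false ps = All-reverse ps

connected-just : ∀ {A : Set} {R : A → A → Set} {u v x y} →
                 u ≡ just x → v ≡ just y → R x y → Connected R u v
connected-just refl refl r = just r

connected-just⁻¹ : ∀ {A : Set} {R : A → A → Set} {u v x y} →
                   u ≡ just x → v ≡ just y → Connected R u v → R x y
connected-just⁻¹ refl refl (just r) = r

linked-concatMap : ∀ {A B : Set} {P : A → Set} {R : A → A → Set} {R′ : B → B → Set} (f : A → List B) →
                   (∀ {x} → P x → Linked R′ (f x)) →
                   (∀ {x} → P x → Σ B λ h → head (f x) ≡ just h) →
                   (∀ {x y} → P x → P y → R x y → Connected R′ (last (f x)) (head (f y))) →
                   ∀ {xs} → All P xs → Linked R xs → Linked R′ (concatMap f xs)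
linked-concatMap f blocks heads seams {[]}    []       [] = []
linked-concatMap f blocks heads seams {x ∷ []} (px ∷ []) [-] =
  subst (Linked _) (sym (++-identityʳ (f x))) (blocks px)
linked-concatMap {R′ = R′} f blocks heads seams {x ∷ y ∷ xs} (px ∷ py ∷ ps) (r ∷ rs) =
  Linked.++⁺ (blocks px)
             (subst (Connected R′ (last (f x))) (sym (head-++ (f y) _ (proj₂ (heads py)))) (seams px py r))
             (linked-concatMap f blocks heads seams (py ∷ ps) rs)

mismatch : Sym → Sym → ℕ
mismatch x y = if symEq x y then 0 else 1

symEq-refl : ∀ x → symEq x x ≡ true
symEq-refl O = refl
symEq-refl I = refl
symEq-refl S = refl

mismatch-comm : ∀ x y → mismatch x y ≡ mismatch y x
mismatch-comm O O = refl
mismatch-comm O I = refl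
mismatch-comm O S = refl
mismatch-comm I O = refl
mismatch-comm I I = refl
mismatch-comm I S = refl
mismatch-comm S O = refl
mismatch-comm S I = refl
mismatch-comm S S = refl

mismatch≤1 : ∀ x y → mismatch x y ≤ 1
mismatch≤1 x y with symEq x y
... | true  = z≤n
... | false = s≤s z≤n

hamming-refl : ∀ xs → hamming xs xs ≡ 0
hamming-refl []       = refl
hamming-refl (x ∷ xs) rewrite symEq-refl x = hamming-refl xs

hamming-comm : ∀ xs ys → hamming xs ys ≡ hamming ys xs
hamming-comm []       []       = refl
hamming-comm []       (y ∷ ys) = cong suc (hamming-comm [] ys)
hamming-comm (x ∷ xs) []       = cong suc (hamming-comm xs [])
hamming-comm (x ∷ xs) (y ∷ ys) = cong₂ _+_ (mismatch-comm x y) (hamming-comm xs ys)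

hamming-++ : ∀ xs ys {zs ws} → length xs ≡ length ys →
             hamming (xs ++ zs) (ys ++ ws) ≡ hamming xs ys + hamming zs ws
hamming-++ []       []       _  = refl
hamming-++ (x ∷ xs) (y ∷ ys) eq = trans (cong (mismatch x y +_) (hamming-++ xs ys (suc-injective eq)))
  (sym (+-assoc (mismatch x y) (hamming xs ys) _))

infix 5 _⟨_⟩_
_⟨_⟩_ : Sym → Chain → Sym → Chain
a ⟨ xs ⟩ b = a ∷ xs ++ [ b ]

record Near (k : ℕ) (xs ys : Chain) : Set where
  constructor near
  field
    same-length : length xs ≡ length ys
    distance    : hamming xs ys ≤ k

near-refl : ∀ xs → Near 0 xs xs
near-refl xs = near refl (≤-reflexive (hamming-refl xs))

near-sym : ∀ {k xs ys} → Near k xs ys → Near k ys xs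
near-sym {k} {xs} {ys} (near eq h) = near (sym eq) (subst (_≤ k) (hamming-comm xs ys) h)

near-wrap : ∀ a b c d {k xs ys} → Near k xs ys →
            Near (mismatch a c + (k + (mismatch b d + 0))) (a ⟨ xs ⟩ b) (c ⟨ ys ⟩ d)
near-wrap a b c d {xs = xs} {ys} (near eq h) = near
  (cong suc (trans (length-++ xs) (trans (cong (_+ 1) eq) (sym (length-++ ys)))))
  (≤-trans (≤-reflexive (cong (mismatch a c +_) (hamming-++ xs ys eq)))
           (+-monoʳ-≤ (mismatch a c) (+-monoˡ-≤ (mismatch b d + 0) h)))

Close : Chain → Chain → Set
Close x y = hamming x y ≤ 3

-- The bound k is a closed numeral at every use, so the side condition computes to ⊤.
near⇒close : ∀ {k x y} → Near k x y → {T (k ≤ᵇ 3)} → Close x y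
near⇒close (near _ h) {k≤3} = ≤-trans h (≤ᵇ⇒≤ _ 3 k≤3)

Close-sym : ∀ x y → Close x y → Close y x
Close-sym x y = subst (_≤ 3) (hamming-comm x y)

fillFirst : Sym → Chain → Chain
fillFirst x []      = []
fillFirst x (S ∷ c) = x ∷ c
fillFirst x (O ∷ c) = O ∷ fillFirst x c
fillFirst x (I ∷ c) = I ∷ fillFirst x c

fillLast : Sym → Chain → Chain
fillLast x []      = []
fillLast x (S ∷ c) = if stars c ≡ᵇ 0 then x ∷ c else S ∷ fillLast x c
fillLast x (O ∷ c) = O ∷ fillLast x c
fillLast x (I ∷ c) = I ∷ fillLast x c

data Letter : Sym → Set where
  letterO : Letter O
  letterI : Letter I

length-fillFirst : ∀ x c → length (fillFirst x c) ≡ length c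
length-fillFirst x []      = refl
length-fillFirst x (S ∷ c) = refl
length-fillFirst x (O ∷ c) = cong suc (length-fillFirst x c)
length-fillFirst x (I ∷ c) = cong suc (length-fillFirst x c)

length-fillLast : ∀ x c → length (fillLast x c) ≡ length c
length-fillLast x []      = refl
length-fillLast x (S ∷ c) with stars c
... | zero  = refl
... | suc _ = cong suc (length-fillLast x c)
length-fillLast x (O ∷ c) = cong suc (length-fillLast x c)
length-fillLast x (I ∷ c) = cong suc (length-fillLast x c)

stars-fillFirst : ∀ {x k} c → Letter x → stars c ≡ suc k → stars (fillFirst x c) ≡ k
stars-fillFirst (S ∷ c) letterO eq = suc-injective eq
stars-fillFirst (S ∷ c) letterI eq = suc-injective eq
stars-fillFirst (O ∷ c) l eq = stars-fillFirst c l eq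
stars-fillFirst (I ∷ c) l eq = stars-fillFirst c l eq

stars-fillLast : ∀ {x k} c → Letter x → stars c ≡ suc k → stars (fillLast x c) ≡ k
stars-fillLast (S ∷ c) l eq with stars c in e
stars-fillLast (S ∷ c) letterO eq | zero  = trans e (suc-injective eq)
stars-fillLast (S ∷ c) letterI eq | zero  = trans e (suc-injective eq)
... | suc j = trans (cong suc (stars-fillLast c l e)) (suc-injective eq)
stars-fillLast (O ∷ c) l eq = stars-fillLast c l eq
stars-fillLast (I ∷ c) l eq = stars-fillLast c l eq

fillFirst-unstarred : ∀ x c → stars c ≡ 0 → fillFirst x c ≡ c
fillFirst-unstarred x []      _  = refl
fillFirst-unstarred x (O ∷ c) eq = cong (O ∷_) (fillFirst-unstarred x c eq)
fillFirst-unstarred x (I ∷ c) eq = cong (I ∷_) (fillFirst-unstarred x c eq)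

fillLast-unstarred : ∀ x c → stars c ≡ 0 → fillLast x c ≡ c
fillLast-unstarred x []      _  = refl
fillLast-unstarred x (O ∷ c) eq = cong (O ∷_) (fillLast-unstarred x c eq)
fillLast-unstarred x (I ∷ c) eq = cong (I ∷_) (fillLast-unstarred x c eq)

fillLast-∷-star : ∀ x c {k} → stars c ≡ suc k → fillLast x (S ∷ c) ≡ S ∷ fillLast x c
fillLast-∷-star x c eq rewrite eq = refl

stars-++ : ∀ xs ys → stars (xs ++ ys) ≡ stars xs + stars ys
stars-++ []       ys = refl
stars-++ (S ∷ xs) ys = cong suc (stars-++ xs ys)
stars-++ (O ∷ xs) ys = stars-++ xs ys
stars-++ (I ∷ xs) ys = stars-++ xs ys

stars-∷ʳ-letter : ∀ xs {y} → Letter y → stars (xs ++ [ y ]) ≡ stars xs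
stars-∷ʳ-letter xs letterO = trans (stars-++ xs [ O ]) (+-identityʳ (stars xs))
stars-∷ʳ-letter xs letterI = trans (stars-++ xs [ I ]) (+-identityʳ (stars xs))

stars-∷ʳ-star : ∀ xs → stars (xs ++ [ S ]) ≡ suc (stars xs)
stars-∷ʳ-star xs = trans (stars-++ xs [ S ]) (+-comm (stars xs) 1)

stars-reverse : ∀ xs → stars (reverse xs) ≡ stars xs
stars-reverse []       = refl
stars-reverse (x ∷ xs) = begin
  stars (reverse (x ∷ xs))       ≡⟨ cong stars (unfold-reverse x xs) ⟩
  stars (reverse xs ++ [ x ])    ≡⟨ stars-++ (reverse xs) [ x ] ⟩
  stars (reverse xs) + stars [ x ] ≡⟨ cong (_+ stars [ x ]) (stars-reverse xs) ⟩
  stars xs + stars [ x ]         ≡⟨ +-comm (stars xs) (stars [ x ]) ⟩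
  stars [ x ] + stars xs         ≡⟨ stars-++ [ x ] xs ⟨
  stars (x ∷ xs)                 ∎
  where open ≡-Reasoning

fillFirst-++-starred : ∀ x {k} ys zs → stars ys ≡ suc k → fillFirst x (ys ++ zs) ≡ fillFirst x ys ++ zs
fillFirst-++-starred x (S ∷ ys) zs eq = refl
fillFirst-++-starred x (O ∷ ys) zs eq = cong (O ∷_) (fillFirst-++-starred x ys zs eq)
fillFirst-++-starred x (I ∷ ys) zs eq = cong (I ∷_) (fillFirst-++-starred x ys zs eq)

fillFirst-++-unstarred : ∀ x ys zs → stars ys ≡ 0 → fillFirst x (ys ++ zs) ≡ ys ++ fillFirst x zs
fillFirst-++-unstarred x []       zs eq = refl
fillFirst-++-unstarred x (O ∷ ys) zs eq = cong (O ∷_) (fillFirst-++-unstarred x ys zs eq)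
fillFirst-++-unstarred x (I ∷ ys) zs eq = cong (I ∷_) (fillFirst-++-unstarred x ys zs eq)

fillFirst-∷ʳ-letter : ∀ x ys {y} → Letter y → fillFirst x (ys ++ [ y ]) ≡ fillFirst x ys ++ [ y ]
fillFirst-∷ʳ-letter x []       letterO = refl
fillFirst-∷ʳ-letter x []       letterI = refl
fillFirst-∷ʳ-letter x (S ∷ ys) l = refl
fillFirst-∷ʳ-letter x (O ∷ ys) l = cong (O ∷_) (fillFirst-∷ʳ-letter x ys l)
fillFirst-∷ʳ-letter x (I ∷ ys) l = cong (I ∷_) (fillFirst-∷ʳ-letter x ys l)

fillLast-∷ʳ-star : ∀ x ys → fillLast x (ys ++ [ S ]) ≡ ys ++ [ x ]
fillLast-∷ʳ-star x []       = refl
fillLast-∷ʳ-star x (S ∷ ys) rewrite stars-∷ʳ-star ys = cong (S ∷_) (fillLast-∷ʳ-star x ys)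
fillLast-∷ʳ-star x (O ∷ ys) = cong (O ∷_) (fillLast-∷ʳ-star x ys)
fillLast-∷ʳ-star x (I ∷ ys) = cong (I ∷_) (fillLast-∷ʳ-star x ys)

fillLast-∷ʳ-letter : ∀ x ys {y} → Letter y → fillLast x (ys ++ [ y ]) ≡ fillLast x ys ++ [ y ]
fillLast-∷ʳ-letter x []       letterO = refl
fillLast-∷ʳ-letter x []       letterI = refl
fillLast-∷ʳ-letter x (S ∷ ys) l rewrite stars-∷ʳ-letter ys l with stars ys
... | zero  = refl
... | suc _ = cong (S ∷_) (fillLast-∷ʳ-letter x ys l)
fillLast-∷ʳ-letter x (O ∷ ys) l = cong (O ∷_) (fillLast-∷ʳ-letter x ys l)
fillLast-∷ʳ-letter x (I ∷ ys) l = cong (I ∷_) (fillLast-∷ʳ-letter x ys l)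

fillFirst-reverse-∷-letter : ∀ x {y} zs ws → Letter y → fillFirst x (reverse zs) ≡ reverse ws →
                             fillFirst x (reverse (y ∷ zs)) ≡ reverse (y ∷ ws)
fillFirst-reverse-∷-letter x {y} zs ws l eq = begin
  fillFirst x (reverse (y ∷ zs))    ≡⟨ cong (fillFirst x) (unfold-reverse y zs) ⟩
  fillFirst x (reverse zs ++ [ y ]) ≡⟨ fillFirst-∷ʳ-letter x (reverse zs) l ⟩
  fillFirst x (reverse zs) ++ [ y ] ≡⟨ cong (_++ [ y ]) eq ⟩
  reverse ws ++ [ y ]               ≡⟨ unfold-reverse y ws ⟨
  reverse (y ∷ ws)                  ∎
  where open ≡-Reasoning

fillFirst-reverse : ∀ x zs → fillFirst x (reverse zs) ≡ reverse (fillLast x zs)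
fillFirst-reverse x []       = refl
fillFirst-reverse x (O ∷ zs) = fillFirst-reverse-∷-letter x zs (fillLast x zs) letterO (fillFirst-reverse x zs)
fillFirst-reverse x (I ∷ zs) = fillFirst-reverse-∷-letter x zs (fillLast x zs) letterI (fillFirst-reverse x zs)
fillFirst-reverse x (S ∷ zs) with stars zs in e
... | zero = begin
  fillFirst x (reverse (S ∷ zs))   ≡⟨ cong (fillFirst x) (unfold-reverse S zs) ⟩
  fillFirst x (reverse zs ++ [ S ]) ≡⟨ fillFirst-++-unstarred x (reverse zs) [ S ] (trans (stars-reverse zs) e) ⟩
  reverse zs ++ [ x ]               ≡⟨ unfold-reverse x zs ⟨
  reverse (x ∷ zs)                  ∎
  where open ≡-Reasoning
... | suc k = begin
  fillFirst x (reverse (S ∷ zs))   ≡⟨ cong (fillFirst x) (unfold-reverse S zs) ⟩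
  fillFirst x (reverse zs ++ [ S ]) ≡⟨ fillFirst-++-starred x (reverse zs) [ S ] (trans (stars-reverse zs) e) ⟩
  fillFirst x (reverse zs) ++ [ S ] ≡⟨ cong (_++ [ S ]) (fillFirst-reverse x zs) ⟩
  reverse (fillLast x zs) ++ [ S ]  ≡⟨ unfold-reverse S (fillLast x zs) ⟨
  reverse (S ∷ fillLast x zs)       ∎
  where open ≡-Reasoning

hamming-fillFirst : ∀ x c → hamming c (fillFirst x c) ≤ 1
hamming-fillFirst x []      = z≤n
hamming-fillFirst x (S ∷ c) rewrite hamming-refl c = +-monoˡ-≤ 0 (mismatch≤1 S x)
hamming-fillFirst x (O ∷ c) = hamming-fillFirst x c
hamming-fillFirst x (I ∷ c) = hamming-fillFirst x c

hamming-fillLast : ∀ x c → hamming c (fillLast x c) ≤ 1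
hamming-fillLast x []      = z≤n
hamming-fillLast x (S ∷ c) with stars c
... | zero  rewrite hamming-refl c = +-monoˡ-≤ 0 (mismatch≤1 S x)
... | suc _ = hamming-fillLast x c
hamming-fillLast x (O ∷ c) = hamming-fillLast x c
hamming-fillLast x (I ∷ c) = hamming-fillLast x c

hamming-fillFirst-fillLast : ∀ x {y} c → Letter y → hamming (fillFirst x (fillLast y c)) (fillFirst x c) ≤ 1
hamming-fillFirst-fillLast x []      _ = z≤n
hamming-fillFirst-fillLast x (S ∷ c) l with stars c in e
hamming-fillFirst-fillLast x (S ∷ c) letterO | zero
  rewrite fillFirst-unstarred x c e | hamming-refl c = +-monoˡ-≤ 0 (mismatch≤1 O x)
hamming-fillFirst-fillLast x (S ∷ c) letterI | zero
  rewrite fillFirst-unstarred x c e | hamming-refl c = +-monoˡ-≤ 0 (mismatch≤1 I x)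
hamming-fillFirst-fillLast x {y} (S ∷ c) l | suc _
  rewrite symEq-refl x | hamming-comm (fillLast y c) c = hamming-fillLast y c
hamming-fillFirst-fillLast x (O ∷ c) l = hamming-fillFirst-fillLast x c l
hamming-fillFirst-fillLast x (I ∷ c) l = hamming-fillFirst-fillLast x c l

hamming-fillLast-fillFirst : ∀ {x} y c → Letter x → hamming (fillLast y (fillFirst x c)) (fillLast y c) ≤ 1
hamming-fillLast-fillFirst y []      _ = z≤n
hamming-fillLast-fillFirst y (S ∷ c) l with stars c in e
hamming-fillLast-fillFirst y (S ∷ c) letterO | zero
  rewrite fillLast-unstarred y c e | hamming-refl c = +-monoˡ-≤ 0 (mismatch≤1 O y)
hamming-fillLast-fillFirst y (S ∷ c) letterI | zero
  rewrite fillLast-unstarred y c e | hamming-refl c = +-monoˡ-≤ 0 (mismatch≤1 I y)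
hamming-fillLast-fillFirst y (S ∷ c) letterO | suc _ rewrite hamming-refl (fillLast y c) = ≤-refl
hamming-fillLast-fillFirst y (S ∷ c) letterI | suc _ rewrite hamming-refl (fillLast y c) = ≤-refl
hamming-fillLast-fillFirst y (O ∷ c) l = hamming-fillLast-fillFirst y c l
hamming-fillLast-fillFirst y (I ∷ c) l = hamming-fillLast-fillFirst y c l

hamming-fillFirst-fillLast-single : ∀ x y c → stars c ≡ 1 → hamming (fillFirst x c) (fillLast y c) ≤ 1
hamming-fillFirst-fillLast-single x y (S ∷ c) eq with stars c
... | zero rewrite hamming-refl c = +-monoˡ-≤ 0 (mismatch≤1 x y)
hamming-fillFirst-fillLast-single x y (O ∷ c) eq = hamming-fillFirst-fillLast-single x y c eq
hamming-fillFirst-fillLast-single x y (I ∷ c) eq = hamming-fillFirst-fillLast-single x y c eq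


near-fillFirst : ∀ x c → Near 1 c (fillFirst x c)
near-fillFirst x c = near (sym (length-fillFirst x c)) (hamming-fillFirst x c)

near-fillLast : ∀ x c → Near 1 c (fillLast x c)
near-fillLast x c = near (sym (length-fillLast x c)) (hamming-fillLast x c)

near-fillFirst-fillLast : ∀ x {y} c → Letter y → Near 1 (fillFirst x (fillLast y c)) (fillFirst x c)
near-fillFirst-fillLast x {y} c l = near
  (trans (length-fillFirst x (fillLast y c)) (trans (length-fillLast y c) (sym (length-fillFirst x c))))
  (hamming-fillFirst-fillLast x c l)

near-fillLast-fillFirst : ∀ {x} y c → Letter x → Near 1 (fillLast y (fillFirst x c)) (fillLast y c)
near-fillLast-fillFirst {x} y c l = near
  (trans (length-fillLast y (fillFirst x c)) (trans (length-fillFirst x c) (sym (length-fillLast y c))))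
  (hamming-fillLast-fillFirst y c l)

near-fillFirst-fillLast-single : ∀ x y c → stars c ≡ 1 → Near 1 (fillFirst x c) (fillLast y c)
near-fillFirst-fillLast-single x y c eq = near
  (trans (length-fillFirst x c) (sym (length-fillLast y c)))
  (hamming-fillFirst-fillLast-single x y c eq)

replaceFirstTwo-∷-star : ∀ a b zs → replaceFirstTwo a b (S ∷ zs) ≡ a ∷ fillFirst b zs
replaceFirstTwo-∷-star a b []       = refl
replaceFirstTwo-∷-star a b (S ∷ zs) = refl
replaceFirstTwo-∷-star a b (O ∷ zs) =
  cong (λ t → a ∷ O ∷ t) (∷-injectiveʳ (replaceFirstTwo-∷-star a b zs))
replaceFirstTwo-∷-star a b (I ∷ zs) =
  cong (λ t → a ∷ I ∷ t) (∷-injectiveʳ (replaceFirstTwo-∷-star a b zs))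

ℓ-∷ʳ-star : ∀ zs → ℓ (zs ++ [ S ]) ≡ fillLast O zs ++ [ I ]
ℓ-∷ʳ-star zs = begin
  reverse (replaceFirstTwo I O (reverse (zs ++ [ S ])))
    ≡⟨ cong (λ t → reverse (replaceFirstTwo I O t)) (reverse-++ zs [ S ]) ⟩
  reverse (replaceFirstTwo I O (S ∷ reverse zs))
    ≡⟨ cong reverse (replaceFirstTwo-∷-star I O (reverse zs)) ⟩
  reverse (I ∷ fillFirst O (reverse zs))
    ≡⟨ cong (λ t → reverse (I ∷ t)) (fillFirst-reverse O zs) ⟩
  reverse (I ∷ reverse (fillLast O zs))
    ≡⟨ unfold-reverse I (reverse (fillLast O zs)) ⟩
  reverse (reverse (fillLast O zs)) ++ [ I ]
    ≡⟨ cong (_++ [ I ]) (reverse-involutive (fillLast O zs)) ⟩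
  fillLast O zs ++ [ I ] ∎
  where open ≡-Reasoning

fWrap ℓWrap fℓWrap ℓfWrap : Chain → Chain
fWrap c  = O ⟨ fillFirst I c ⟩ S
ℓWrap c  = S ⟨ fillLast O c ⟩ I
fℓWrap c = O ⟨ fillFirst I (fillLast O c) ⟩ I
ℓfWrap c = O ⟨ fillLast O (fillFirst I c) ⟩ I

f-wrapS : ∀ c {k} → stars c ≡ suc k → f (wrapS c) ≡ fWrap c
f-wrapS c eq = trans (replaceFirstTwo-∷-star O I (c ++ [ S ]))
                     (cong (O ∷_) (fillFirst-++-starred I c [ S ] eq))

f-wrapS-unstarred : ∀ c → stars c ≡ 0 → f (wrapS c) ≡ wrap01 c
f-wrapS-unstarred c eq = trans (replaceFirstTwo-∷-star O I (c ++ [ S ]))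
                               (cong (O ∷_) (fillFirst-++-unstarred I c [ S ] eq))

ℓ-wrapS : ∀ c {k} → stars c ≡ suc k → ℓ (wrapS c) ≡ ℓWrap c
ℓ-wrapS c eq = trans (ℓ-∷ʳ-star (S ∷ c)) (cong (_++ [ I ]) (fillLast-∷-star O c eq))

f-ℓWrap : ∀ c → f (ℓWrap c) ≡ fℓWrap c
f-ℓWrap c = trans (replaceFirstTwo-∷-star O I (fillLast O c ++ [ I ]))
                  (cong (O ∷_) (fillFirst-∷ʳ-letter I (fillLast O c) letterI))

ℓ-fWrap : ∀ c → ℓ (fWrap c) ≡ ℓfWrap c
ℓ-fWrap c = ℓ-∷ʳ-star (O ∷ fillFirst I c)

stars-wrapS : ∀ c → stars (wrapS c) ≡ 2 + stars c
stars-wrapS c = cong suc (stars-∷ʳ-star c)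

stars-wrap01 : ∀ c → stars (wrap01 c) ≡ stars c
stars-wrap01 c = stars-∷ʳ-letter c letterI

stars-fWrap : ∀ c {k} → stars c ≡ suc k → stars (fWrap c) ≡ stars c
stars-fWrap c eq =
  trans (stars-∷ʳ-star (fillFirst I c)) (trans (cong suc (stars-fillFirst c letterI eq)) (sym eq))

stars-ℓWrap : ∀ c {k} → stars c ≡ suc k → stars (ℓWrap c) ≡ stars c
stars-ℓWrap c eq =
  trans (cong suc (trans (stars-∷ʳ-letter (fillLast O c) letterI) (stars-fillLast c letterO eq))) (sym eq)

stars-fℓWrap : ∀ c {k} → stars c ≡ 2 + k → stars (fℓWrap c) ≡ k
stars-fℓWrap c eq = trans (stars-∷ʳ-letter (fillFirst I (fillLast O c)) letterI)
                          (stars-fillFirst (fillLast O c) letterI (stars-fillLast c letterO eq))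

stars-ℓfWrap : ∀ c {k} → stars c ≡ 2 + k → stars (ℓfWrap c) ≡ k
stars-ℓfWrap c eq = trans (stars-∷ʳ-letter (fillLast O (fillFirst I c)) letterI)
                          (stars-fillLast (fillFirst I c) letterO (stars-fillFirst c letterI eq))

length-wrapped : ∀ (a b : Sym) (xs c : Chain) → length xs ≡ length c → length (a ⟨ xs ⟩ b) ≡ 2 + length c
length-wrapped a b xs c eq = cong suc (trans (length-++ xs) (trans (+-comm (length xs) 1) (cong suc eq)))

length-wrapS : ∀ c → length (wrapS c) ≡ 2 + length c
length-wrapS c = length-wrapped S S c c refl

length-wrap01 : ∀ c → length (wrap01 c) ≡ 2 + length c
length-wrap01 c = length-wrapped O I c c refl

length-fWrap : ∀ c → length (fWrap c) ≡ 2 + length c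
length-fWrap c = length-wrapped O S (fillFirst I c) c (length-fillFirst I c)

length-ℓWrap : ∀ c → length (ℓWrap c) ≡ 2 + length c
length-ℓWrap c = length-wrapped S I (fillLast O c) c (length-fillLast O c)

length-fℓWrap : ∀ c → length (fℓWrap c) ≡ 2 + length c
length-fℓWrap c = length-wrapped O I (fillFirst I (fillLast O c)) c
  (trans (length-fillFirst I (fillLast O c)) (length-fillLast O c))

length-ℓfWrap : ∀ c → length (ℓfWrap c) ≡ 2 + length c
length-ℓfWrap c = length-wrapped O I (fillLast O (fillFirst I c)) c
  (trans (length-fillLast O (fillFirst I c)) (length-fillFirst I c))

lamEven-unstarred : ∀ c → stars c ≡ 0 → lamEven c ≡ wrapS c ∷ wrap01 c ∷ []
lamEven-unstarred c eq rewrite eq = refl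

lamEven-starred : ∀ c {k} → stars c ≡ suc k →
                  lamEven c ≡ wrapS c ∷ fWrap c ∷ fℓWrap c ∷ ℓWrap c ∷ []
lamEven-starred c eq rewrite eq | f-wrapS c eq | ℓ-wrapS c eq | f-ℓWrap c = refl

lamOdd-single : ∀ c → stars c ≡ 1 → lamOdd c ≡ wrapS c ∷ ℓWrap c ∷ fWrap c ∷ []
lamOdd-single c eq rewrite eq | f-wrapS c eq | ℓ-wrapS c eq = refl

lamOdd-multiple : ∀ c {k} → stars c ≡ 2 + k →
                  lamOdd c ≡ wrapS c ∷ ℓWrap c ∷ ℓfWrap c ∷ fWrap c ∷ []
lamOdd-multiple c eq rewrite eq | ℓ-wrapS c eq =
  trans (cong (λ t → wrapS c ∷ ℓWrap c ∷ ℓ t ∷ t ∷ []) (f-wrapS c eq))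
        (cong (λ t → wrapS c ∷ ℓWrap c ∷ t ∷ fWrap c ∷ []) (ℓ-fWrap c))

lam-even : ∀ m c → isEven m ≡ true → lam m c ≡ lamEven c
lam-even m c ev rewrite ev = refl

lam-odd : ∀ m c → isEven m ≡ false → lam m c ≡ lamOdd c
lam-odd m c ev rewrite ev = refl

last-lam-even-unstarred : ∀ m c → isEven m ≡ true → stars c ≡ 0 → last (lam m c) ≡ just (wrap01 c)
last-lam-even-unstarred m c ev eq = cong last (trans (lam-even m c ev) (lamEven-unstarred c eq))

last-lam-even-starred : ∀ m c {k} → isEven m ≡ true → stars c ≡ suc k → last (lam m c) ≡ just (ℓWrap c)
last-lam-even-starred m c ev eq = cong last (trans (lam-even m c ev) (lamEven-starred c eq))

last-lam-odd-starred : ∀ m c {k} → isEven m ≡ false → stars c ≡ suc k → last (lam m c) ≡ just (fWrap c)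
last-lam-odd-starred m c {zero}  ev eq = cong last (trans (lam-odd m c ev) (lamOdd-single c eq))
last-lam-odd-starred m c {suc k} ev eq = cong last (trans (lam-odd m c ev) (lamOdd-multiple c eq))

last-lamOdd-unstarred : ∀ c → stars c ≡ 0 → last (lamOdd c) ≡ just (wrap01 c)
last-lamOdd-unstarred c sc rewrite sc = cong just (f-wrapS-unstarred c sc)

last-lam : ∀ n c → Σ Chain λ e → last (lam n c) ≡ just e × stars e ≡ stars c × length e ≡ 2 + length c
last-lam n c = by-cases (isEven n) refl (stars c) refl
  where
  by-cases : ∀ b → isEven n ≡ b → ∀ s → stars c ≡ s →
             Σ Chain λ e → last (lam n c) ≡ just e × stars e ≡ stars c × length e ≡ 2 + length c
  by-cases true  ev zero    sc = wrap01 c , last-lam-even-unstarred n c ev sc , stars-wrap01 c , length-wrap01 c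
  by-cases true  ev (suc k) sc = ℓWrap c , last-lam-even-starred n c ev sc , stars-ℓWrap c sc , length-ℓWrap c
  by-cases false ev zero    sc = wrap01 c , trans (cong last (lam-odd n c ev)) (last-lamOdd-unstarred c sc)
                                         , stars-wrap01 c , length-wrap01 c
  by-cases false ev (suc k) sc = fWrap c , last-lam-odd-starred n c ev sc , stars-fWrap c sc , length-fWrap c

head-lam : ∀ m c → head (lam m c) ≡ just (wrapS c)
head-lam m c with isEven m
... | true with stars c
...   | zero  = refl
...   | suc _ = refl
head-lam m c | false with stars c
...   | zero        = refl
...   | suc zero    = refl
...   | suc (suc _) = refl

data Mod4 : Set where
  r0 r1 r2 r3 : Mod4

-- n % 4 by structural recursion, so that mod4 (4 + n) reduces to mod4 n.
mod4 : ℕ → Mod4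
mod4 0 = r0
mod4 1 = r1
mod4 2 = r2
mod4 3 = r3
mod4 (suc (suc (suc (suc n)))) = mod4 n

toℕ₄ : Mod4 → ℕ
toℕ₄ r0 = 0
toℕ₄ r1 = 1
toℕ₄ r2 = 2
toℕ₄ r3 = 3

shift2 : Mod4 → Mod4
shift2 r0 = r2
shift2 r1 = r3
shift2 r2 = r0
shift2 r3 = r1

%4≡toℕ₄-mod4 : ∀ n → n % 4 ≡ toℕ₄ (mod4 n)
%4≡toℕ₄-mod4 0 = refl
%4≡toℕ₄-mod4 1 = refl
%4≡toℕ₄-mod4 2 = refl
%4≡toℕ₄-mod4 3 = refl
%4≡toℕ₄-mod4 (suc (suc (suc (suc n)))) =
  trans (trans (cong (_% 4) (+-comm 4 n)) ([m+n]%n≡m%n n 4)) (%4≡toℕ₄-mod4 n)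

mod4-2+ : ∀ n → mod4 (2 + n) ≡ shift2 (mod4 n)
mod4-2+ 0 = refl
mod4-2+ 1 = refl
mod4-2+ 2 = refl
mod4-2+ 3 = refl
mod4-2+ (suc (suc (suc (suc n)))) = mod4-2+ n

shift2-involutive : ∀ r → shift2 (shift2 r) ≡ r
shift2-involutive r0 = refl
shift2-involutive r1 = refl
shift2-involutive r2 = refl
shift2-involutive r3 = refl

even₄ : Mod4 → Bool
even₄ r0 = true
even₄ r1 = false
even₄ r2 = true
even₄ r3 = false

isEven≡even₄-mod4 : ∀ n → isEven n ≡ even₄ (mod4 n)
isEven≡even₄-mod4 0 = refl
isEven≡even₄-mod4 1 = refl
isEven≡even₄-mod4 2 = refl
isEven≡even₄-mod4 3 = refl
isEven≡even₄-mod4 (suc (suc (suc (suc n)))) = isEven≡even₄-mod4 n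

turn : Bool → Mod4 → Mod4
turn true  r = r
turn false r = shift2 r

shift2-turn : ∀ b r → shift2 (turn b r) ≡ turn b (shift2 r)
shift2-turn true  r = refl
shift2-turn false r = refl

record Oriented (b : Bool) (s n : ℕ) : Set where
  constructor oriented
  field residue : mod4 s ≡ turn b (mod4 n)

turn-flag : ∀ b r → (toℕ₄ (turn b r) ≡ᵇ toℕ₄ r) ≡ b
turn-flag true  r0 = refl
turn-flag true  r1 = refl
turn-flag true  r2 = refl
turn-flag true  r3 = refl
turn-flag false r0 = refl
turn-flag false r1 = refl
turn-flag false r2 = refl
turn-flag false r3 = refl

even₄-turn : ∀ b r → even₄ (turn b r) ≡ even₄ r
even₄-turn true  r  = refl
even₄-turn false r0 = refl
even₄-turn false r1 = refl
even₄-turn false r2 = refl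
even₄-turn false r3 = refl

isEven-oriented : ∀ {b s n} → Oriented b s n → isEven s ≡ isEven n
isEven-oriented {b} {s} {n} (oriented o) = begin
  isEven s                  ≡⟨ isEven≡even₄-mod4 s ⟩
  even₄ (mod4 s)            ≡⟨ cong even₄ o ⟩
  even₄ (turn b (mod4 n))   ≡⟨ even₄-turn b (mod4 n) ⟩
  even₄ (mod4 n)            ≡⟨ isEven≡even₄-mod4 n ⟨
  isEven n                  ∎
  where open ≡-Reasoning

oriented-wrap : ∀ {b s s′ n} → Oriented b s n → s′ ≡ 2 + s → Oriented b s′ (2 + n)
oriented-wrap {b} {s} {s′} {n} (oriented o) refl = oriented $ begin
  mod4 (2 + s)              ≡⟨ mod4-2+ s ⟩
  shift2 (mod4 s)           ≡⟨ cong shift2 o ⟩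
  shift2 (turn b (mod4 n))  ≡⟨ shift2-turn b (mod4 n) ⟩
  turn b (shift2 (mod4 n))  ≡⟨ cong (turn b) (mod4-2+ n) ⟨
  turn b (mod4 (2 + n))     ∎
  where open ≡-Reasoning

oriented-flip : ∀ {b s s′ n} → Oriented b s n → s′ ≡ s → Oriented (not b) s′ (2 + n)
oriented-flip {b} {s} {s′} {n} (oriented o) refl = oriented $ begin
  mod4 s                          ≡⟨ o ⟩
  turn b (mod4 n)                 ≡⟨ turn-not b (mod4 n) ⟩
  turn (not b) (shift2 (mod4 n))  ≡⟨ cong (turn (not b)) (mod4-2+ n) ⟨
  turn (not b) (mod4 (2 + n))     ∎
  where
  open ≡-Reasoning
  turn-not : ∀ b r → turn b r ≡ turn (not b) (shift2 r)
  turn-not true  r = sym (shift2-involutive r)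
  turn-not false r = refl

oriented-unwrap : ∀ {b s s′ n} → Oriented b s n → s ≡ 2 + s′ → Oriented b s′ (2 + n)
oriented-unwrap {b} {s} {s′} {n} (oriented o) refl = oriented $ begin
  mod4 s′                          ≡⟨ shift2-involutive (mod4 s′) ⟨
  shift2 (shift2 (mod4 s′))        ≡⟨ cong shift2 (mod4-2+ s′) ⟨
  shift2 (mod4 (2 + s′))           ≡⟨ cong shift2 o ⟩
  shift2 (turn b (mod4 n))         ≡⟨ shift2-turn b (mod4 n) ⟩
  turn b (shift2 (mod4 n))         ≡⟨ cong (turn b) (mod4-2+ n) ⟨
  turn b (mod4 (2 + n))            ∎
  where open ≡-Reasoning

ρ-oriented : ∀ b n c → Oriented b (stars c) n → ρ n c ≡ orient b (lam n c)
ρ-oriented b n c (oriented o)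
  rewrite %4≡toℕ₄-mod4 (stars c) | %4≡toℕ₄-mod4 n | o | turn-flag b (mod4 n) with b
... | true  = refl
... | false = refl

exit entry : Bool → ℕ → Chain → Maybe Chain
exit  true  m c = last (lam m c)
exit  false m c = just (wrapS c)
entry true  m c = just (wrapS c)
entry false m c = last (lam m c)

last-ρ : ∀ b m c → Oriented b (stars c) m → last (ρ m c) ≡ exit b m c
last-ρ true  m c o = cong last (ρ-oriented true m c o)
last-ρ false m c o = trans (cong last (ρ-oriented false m c o))
                             (trans (last-reverse (lam m c)) (head-lam m c))

head-ρ : ∀ b m c → Oriented b (stars c) m → head (ρ m c) ≡ entry b m c
head-ρ true  m c o = trans (cong head (ρ-oriented true m c o)) (head-lam m c)
head-ρ false m c o = trans (cong head (ρ-oriented false m c o)) (head-reverse (lam m c))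

record Smooth (m : ℕ) (x y : Chain) : Set where
  constructor _,_
  field
    close      : Close x y
    seam-close : Connected Close (last (ρ m x)) (head (ρ m y))

smooth : ∀ b b′ {m x y} → Oriented b (stars x) m → Oriented b′ (stars y) m → Close x y →
         Connected Close (exit b m x) (entry b′ m y) → Smooth m x y
smooth b b′ {m} {x} {y} ox oy xy ends =
  xy , subst₂ (Connected Close) (sym (last-ρ b m x ox)) (sym (head-ρ b′ m y oy)) ends

Connected-Close-sym : ∀ {u v} → Connected Close u v → Connected Close v u
Connected-Close-sym = Connected.sym (λ {x} {y} → Close-sym x y)

close-wrapS : ∀ x y → length x ≡ length y → Close x y → Close (wrapS x) (wrapS y)
close-wrapS x y eq xy = near⇒close (near-wrap S S S S (near {xs = x} {ys = y} eq xy))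

module _ {m : ℕ} where

  linked-orient₂ : ∀ b p q → Oriented b (stars p) m → Oriented (not b) (stars q) m →
                   Close p q → Connected Close (last (lam m p)) (last (lam m q)) →
                   Linked (Smooth m) (orient b (p ∷ q ∷ []))
  linked-orient₂ true  p q op oq pq ends = smooth true false op oq pq ends ∷ [-]
  linked-orient₂ false p q op oq pq ends =
    smooth true false oq op (Close-sym p q pq) (Connected-Close-sym ends) ∷ [-]

  linked-orient₃ : ∀ b p q r → Oriented b (stars p) m → Oriented (not b) (stars q) m →
                   Oriented (not b) (stars r) m → Close p q → Close q r →
                   Connected Close (last (lam m p)) (last (lam m q)) →
                   Connected Close (just (wrapS q)) (last (lam m r)) →
                   Linked (Smooth m) (orient b (p ∷ q ∷ r ∷ []))
  linked-orient₃ true  p q r op oq or pq qr pq-ends qr-ends =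
    smooth true false op oq pq pq-ends ∷ smooth false false oq or qr qr-ends ∷ [-]
  linked-orient₃ false p q r op oq or pq qr pq-ends qr-ends =
      smooth true true or oq (Close-sym q r qr) (Connected-Close-sym qr-ends)
    ∷ smooth true false oq op (Close-sym p q pq) (Connected-Close-sym pq-ends) ∷ [-]

  linked-orient₄ : ∀ b p q r s → Oriented b (stars p) m → Oriented (not b) (stars q) m →
                   Oriented b (stars r) m → Oriented (not b) (stars s) m →
                   Close p q → Close q r → Close r s → length q ≡ length r →
                   Connected Close (last (lam m p)) (last (lam m q)) →
                   Connected Close (last (lam m r)) (last (lam m s)) →
                   Linked (Smooth m) (orient b (p ∷ q ∷ r ∷ s ∷ []))
  linked-orient₄ true  p q r s op oq or os pq qr rs |q|≡|r| pq-ends rs-ends =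
      smooth true false op oq pq pq-ends
    ∷ smooth false true oq or qr (just (close-wrapS q r |q|≡|r| qr))
    ∷ smooth true false or os rs rs-ends ∷ [-]
  linked-orient₄ false p q r s op oq or os pq qr rs |q|≡|r| pq-ends rs-ends =
      smooth true false os or (Close-sym r s rs) (Connected-Close-sym rs-ends)
    ∷ smooth false true or oq (Close-sym q r qr) (just (close-wrapS r q (sym |q|≡|r|) (Close-sym q r qr)))
    ∷ smooth true false oq op (Close-sym p q pq) (Connected-Close-sym pq-ends) ∷ [-]

close-wrapS-wrap01 : ∀ c → Close (wrapS c) (wrap01 c)
close-wrapS-wrap01 c = near⇒close (near-wrap S S O I (near-refl c))

close-wrapS-fWrap : ∀ c → Close (wrapS c) (fWrap c)
close-wrapS-fWrap c = near⇒close (near-wrap S S O S (near-fillFirst I c))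

close-fWrap-fℓWrap : ∀ c → Close (fWrap c) (fℓWrap c)
close-fWrap-fℓWrap c = near⇒close (near-wrap O S O I (near-sym (near-fillFirst-fillLast I c letterO)))

close-fℓWrap-ℓWrap : ∀ c → Close (fℓWrap c) (ℓWrap c)
close-fℓWrap-ℓWrap c = near⇒close (near-wrap O I S I (near-sym (near-fillFirst I (fillLast O c))))

close-wrapS-ℓWrap : ∀ c → Close (wrapS c) (ℓWrap c)
close-wrapS-ℓWrap c = near⇒close (near-wrap S S S I (near-fillLast O c))

close-ℓWrap-ℓfWrap : ∀ c → Close (ℓWrap c) (ℓfWrap c)
close-ℓWrap-ℓfWrap c = near⇒close (near-wrap S I O I (near-sym (near-fillLast-fillFirst O c letterI)))

close-ℓfWrap-fWrap : ∀ c → Close (ℓfWrap c) (fWrap c)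
close-ℓfWrap-fWrap c = near⇒close (near-wrap O I O S (near-sym (near-fillLast O (fillFirst I c))))

close-ℓWrap-fWrap-single : ∀ c → stars c ≡ 1 → Close (ℓWrap c) (fWrap c)
close-ℓWrap-fWrap-single c eq =
  near⇒close (near-wrap S I O S (near-sym (near-fillFirst-fillLast-single I O c eq)))

ℓWrap-∷ʳ-star : ∀ xs → ℓWrap (xs ++ [ S ]) ≡ S ⟨ xs ++ [ O ] ⟩ I
ℓWrap-∷ʳ-star xs = cong (λ t → S ⟨ t ⟩ I) (fillLast-∷ʳ-star O xs)

ℓWrap-∷ʳ-letter : ∀ xs {y} → Letter y → ℓWrap (xs ++ [ y ]) ≡ S ⟨ fillLast O xs ++ [ y ] ⟩ I
ℓWrap-∷ʳ-letter xs l = cong (λ t → S ⟨ t ⟩ I) (fillLast-∷ʳ-letter O xs l)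

fWrap-∷ʳ-letter : ∀ xs {y} → Letter y → fWrap (xs ++ [ y ]) ≡ O ⟨ fillFirst I xs ++ [ y ] ⟩ S
fWrap-∷ʳ-letter xs l = cong (λ t → O ⟨ t ⟩ S) (fillFirst-∷ʳ-letter I xs l)

ℓWrap-ℓWrap : ∀ c {k} → stars (fillLast O c) ≡ suc k →
              ℓWrap (ℓWrap c) ≡ S ⟨ S ⟨ fillLast O (fillLast O c) ⟩ I ⟩ I
ℓWrap-ℓWrap c eq = trans (ℓWrap-∷ʳ-letter (S ∷ fillLast O c) letterI)
                         (cong (λ t → S ⟨ t ++ [ I ] ⟩ I) (fillLast-∷-star O (fillLast O c) eq))

close-ℓWrap-wrapS-wrap01-wrap01 : ∀ c → Close (ℓWrap (wrapS c)) (wrap01 (wrap01 c))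
close-ℓWrap-wrapS-wrap01-wrap01 c = subst (λ t → Close t (wrap01 (wrap01 c))) (sym (ℓWrap-∷ʳ-star (S ∷ c)))
  (near⇒close (near-wrap S I O I (near-wrap S O O I (near-refl c))))

close-ℓWrap-wrapS-fWrap : ∀ c → Close (ℓWrap (wrapS c)) (ℓWrap (fWrap c))
close-ℓWrap-wrapS-fWrap c =
  subst₂ Close (sym (ℓWrap-∷ʳ-star (S ∷ c))) (sym (ℓWrap-∷ʳ-star (O ∷ fillFirst I c)))
    (near⇒close (near-wrap S I S I (near-wrap S O O O (near-fillFirst I c))))

close-ℓWrap-fℓWrap-ℓWrap : ∀ c {k} → stars (fillLast O c) ≡ suc k →
                           Close (ℓWrap (fℓWrap c)) (ℓWrap (ℓWrap c))
close-ℓWrap-fℓWrap-ℓWrap c eq =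
  subst₂ Close (sym (ℓWrap-∷ʳ-letter (O ∷ fillFirst I (fillLast O c)) letterI)) (sym (ℓWrap-ℓWrap c eq))
    (near⇒close (near-wrap S I S I (near-wrap O I S I (near-fillLast-fillFirst O (fillLast O c) letterI))))

close-wrap01-fℓWrap-ℓWrap : ∀ c → stars (fillLast O c) ≡ 1 →
                            Close (wrap01 (fℓWrap c)) (ℓWrap (ℓWrap c))
close-wrap01-fℓWrap-ℓWrap c eq = subst (Close (wrap01 (fℓWrap c))) (sym (ℓWrap-ℓWrap c eq))
  (near⇒close (near-wrap O I S I (near-wrap O I S I (near-fillFirst-fillLast-single I O (fillLast O c) eq))))

close-fWrap-wrapS-ℓWrap : ∀ c → Close (fWrap (wrapS c)) (fWrap (ℓWrap c))
close-fWrap-wrapS-ℓWrap c = near⇒close (near-wrap O S O S (near-wrap I S I I (near-fillLast O c)))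

close-fWrap-ℓfWrap-fWrap : ∀ c {k} → stars (fillFirst I c) ≡ suc k →
                           Close (fWrap (ℓfWrap c)) (fWrap (fWrap c))
close-fWrap-ℓfWrap-fWrap c eq =
  subst₂ Close (sym (fWrap-∷ʳ-letter (O ∷ fillLast O (fillFirst I c)) letterI))
               (sym (cong (λ t → O ⟨ t ⟩ S) (fillFirst-++-starred I (O ∷ fillFirst I c) [ S ] eq)))
    (near⇒close (near-wrap O S O S (near-wrap O I O S (near-fillFirst-fillLast I (fillFirst I c) letterO))))

close-wrapS-ℓWrap-fWrap-fWrap : ∀ c → stars c ≡ 1 → Close (wrapS (ℓWrap c)) (fWrap (fWrap c))
close-wrapS-ℓWrap-fWrap-fWrap c eq =
  subst (Close (wrapS (ℓWrap c)))
    (sym (cong (λ t → O ⟨ t ⟩ S)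
               (fillFirst-++-unstarred I (O ∷ fillFirst I c) [ S ] (stars-fillFirst c letterI eq))))
    (near⇒close (near-wrap S S O S (near-wrap S I O I (near-sym (near-fillFirst-fillLast-single I O c eq)))))

last-lam-fℓWrap-ℓWrap-close : ∀ m c k → isEven m ≡ true → stars c ≡ 2 + k →
                              Connected Close (last (lam m (fℓWrap c))) (last (lam m (ℓWrap c)))
last-lam-fℓWrap-ℓWrap-close m c zero ev sc =
  connected-just (last-lam-even-unstarred m (fℓWrap c) ev (stars-fℓWrap c sc))
                 (last-lam-even-starred m (ℓWrap c) ev (trans (stars-ℓWrap c sc) sc))
                 (close-wrap01-fℓWrap-ℓWrap c (stars-fillLast c letterO sc))
last-lam-fℓWrap-ℓWrap-close m c (suc k) ev sc =
  connected-just (last-lam-even-starred m (fℓWrap c) ev (stars-fℓWrap c sc))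
                 (last-lam-even-starred m (ℓWrap c) ev (trans (stars-ℓWrap c sc) sc))
                 (close-ℓWrap-fℓWrap-ℓWrap c (stars-fillLast c letterO sc))

Admissible : ℕ → Chain → Set
Admissible n c = length c ≡ n × Σ Bool λ b → Oriented b (stars c) n

Block : ℕ → Chain → Set
Block n c = All (Admissible (2 + n)) (ρ n c) × Linked (Smooth (2 + n)) (ρ n c)

admissible : ∀ {b n} (c e : Chain) → length c ≡ n → length e ≡ 2 + length c →
             Oriented b (stars e) (2 + n) → Admissible (2 + n) e
admissible {b} c e lc le o = trans le (cong (2 +_) lc) , b , o

block-even-unstarred : ∀ b n c → isEven n ≡ true → stars c ≡ 0 → length c ≡ n →
                       Oriented b (stars c) n → Block n c
block-even-unstarred b n c ev sc lc o
  rewrite ρ-oriented b n c o | lam-even n c ev | lamEven-unstarred c sc =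
    All-orient b ( admissible c (wrapS c) lc (length-wrapS c) ow
                 ∷ admissible c (wrap01 c) lc (length-wrap01 c) oz ∷ [])
  , linked-orient₂ b (wrapS c) (wrap01 c) ow oz (close-wrapS-wrap01 c)
      (connected-just (last-lam-even-starred (2 + n) (wrapS c) ev (stars-wrapS c))
                      (last-lam-even-unstarred (2 + n) (wrap01 c) ev (trans (stars-wrap01 c) sc))
                      (close-ℓWrap-wrapS-wrap01-wrap01 c))
  where
  ow = oriented-wrap o (stars-wrapS c)
  oz = oriented-flip o (stars-wrap01 c)

block-even-starred : ∀ b n c k → isEven n ≡ true → stars c ≡ 2 + k → length c ≡ n →
                     Oriented b (stars c) n → Block n c
block-even-starred b n c k ev sc lc o
  rewrite ρ-oriented b n c o | lam-even n c ev | lamEven-starred c sc =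
    All-orient b ( admissible c (wrapS c) lc (length-wrapS c) ow
                 ∷ admissible c (fWrap c) lc (length-fWrap c) of
                 ∷ admissible c (fℓWrap c) lc (length-fℓWrap c) ofℓ
                 ∷ admissible c (ℓWrap c) lc (length-ℓWrap c) oℓ ∷ [])
  , linked-orient₄ b (wrapS c) (fWrap c) (fℓWrap c) (ℓWrap c) ow of ofℓ oℓ
      (close-wrapS-fWrap c) (close-fWrap-fℓWrap c) (close-fℓWrap-ℓWrap c)
      (trans (length-fWrap c) (sym (length-fℓWrap c)))
      (connected-just (last-lam-even-starred (2 + n) (wrapS c) ev (stars-wrapS c))
                      (last-lam-even-starred (2 + n) (fWrap c) ev (trans (stars-fWrap c sc) sc))
                      (close-ℓWrap-wrapS-fWrap c))
      (last-lam-fℓWrap-ℓWrap-close (2 + n) c k ev sc)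
  where
  ow  = oriented-wrap o (stars-wrapS c)
  of  = oriented-flip o (stars-fWrap c sc)
  ofℓ = oriented-unwrap o (trans sc (cong (2 +_) (sym (stars-fℓWrap c sc))))
  oℓ  = oriented-flip o (stars-ℓWrap c sc)

block-odd-single : ∀ b n c → isEven n ≡ false → stars c ≡ 1 → length c ≡ n →
                   Oriented b (stars c) n → Block n c
block-odd-single b n c ev sc lc o
  rewrite ρ-oriented b n c o | lam-odd n c ev | lamOdd-single c sc =
    All-orient b ( admissible c (wrapS c) lc (length-wrapS c) ow
                 ∷ admissible c (ℓWrap c) lc (length-ℓWrap c) oℓ
                 ∷ admissible c (fWrap c) lc (length-fWrap c) of ∷ [])
  , linked-orient₃ b (wrapS c) (ℓWrap c) (fWrap c) ow oℓ of
      (close-wrapS-ℓWrap c) (close-ℓWrap-fWrap-single c sc)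
      (connected-just (last-lam-odd-starred (2 + n) (wrapS c) ev (stars-wrapS c))
                      (last-lam-odd-starred (2 + n) (ℓWrap c) ev (trans (stars-ℓWrap c sc) sc))
                      (close-fWrap-wrapS-ℓWrap c))
      (connected-just refl
                      (last-lam-odd-starred (2 + n) (fWrap c) ev (trans (stars-fWrap c sc) sc))
                      (close-wrapS-ℓWrap-fWrap-fWrap c sc))
  where
  ow = oriented-wrap o (stars-wrapS c)
  oℓ = oriented-flip o (stars-ℓWrap c sc)
  of = oriented-flip o (stars-fWrap c sc)

block-odd-multiple : ∀ b n c k → isEven n ≡ false → stars c ≡ 3 + k → length c ≡ n →
                     Oriented b (stars c) n → Block n c
block-odd-multiple b n c k ev sc lc o
  rewrite ρ-oriented b n c o | lam-odd n c ev | lamOdd-multiple c sc =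
    All-orient b ( admissible c (wrapS c) lc (length-wrapS c) ow
                 ∷ admissible c (ℓWrap c) lc (length-ℓWrap c) oℓ
                 ∷ admissible c (ℓfWrap c) lc (length-ℓfWrap c) oℓf
                 ∷ admissible c (fWrap c) lc (length-fWrap c) of ∷ [])
  , linked-orient₄ b (wrapS c) (ℓWrap c) (ℓfWrap c) (fWrap c) ow oℓ oℓf of
      (close-wrapS-ℓWrap c) (close-ℓWrap-ℓfWrap c) (close-ℓfWrap-fWrap c)
      (trans (length-ℓWrap c) (sym (length-ℓfWrap c)))
      (connected-just (last-lam-odd-starred (2 + n) (wrapS c) ev (stars-wrapS c))
                      (last-lam-odd-starred (2 + n) (ℓWrap c) ev (trans (stars-ℓWrap c sc) sc))
                      (close-fWrap-wrapS-ℓWrap c))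
      (connected-just (last-lam-odd-starred (2 + n) (ℓfWrap c) ev (stars-ℓfWrap c sc))
                      (last-lam-odd-starred (2 + n) (fWrap c) ev (trans (stars-fWrap c sc) sc))
                      (close-fWrap-ℓfWrap-fWrap c (stars-fillFirst c letterI sc)))
  where
  ow  = oriented-wrap o (stars-wrapS c)
  oℓ  = oriented-flip o (stars-ℓWrap c sc)
  oℓf = oriented-unwrap o (trans sc (cong (2 +_) (sym (stars-ℓfWrap c sc))))
  of  = oriented-flip o (stars-fWrap c sc)

block : ∀ n c → Admissible n c → Block n c
block n c (lc , b , o) = by-cases (isEven n) refl (stars c) refl
  where
  parity : ∀ {e s} → isEven n ≡ e → stars c ≡ s → isEven s ≡ e
  parity ev sc = trans (cong isEven (sym sc)) (trans (isEven-oriented o) ev)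

  by-cases : ∀ e → isEven n ≡ e → ∀ s → stars c ≡ s → Block n c
  by-cases true  ev zero              sc = block-even-unstarred b n c ev sc lc o
  by-cases true  ev (suc zero)        sc with parity ev sc
  ... | ()
  by-cases true  ev (suc (suc k))     sc = block-even-starred b n c k ev sc lc o
  by-cases false ev zero              sc with parity ev sc
  ... | ()
  by-cases false ev (suc zero)        sc = block-odd-single b n c ev sc lc o
  by-cases false ev (suc (suc zero))  sc with parity ev sc
  ... | ()
  by-cases false ev (suc (suc (suc k))) sc = block-odd-multiple b n c k ev sc lc o

Seam : Bool → ℕ → Maybe Chain → Set
Seam b m u = Σ Chain λ e → u ≡ just e × length e ≡ m × Oriented b (stars e) m

last-ρ-seam : ∀ n c → Admissible n c → Seam false (2 + n) (last (ρ n c))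
last-ρ-seam n c (lc , true , o) with last-lam n c
... | e , eq , se , le =
  e , trans (last-ρ true n c o) eq , trans le (cong (2 +_) lc) , oriented-flip o se
last-ρ-seam n c (lc , false , o) =
  wrapS c , last-ρ false n c o , trans (length-wrapS c) (cong (2 +_) lc) , oriented-wrap o (stars-wrapS c)

head-ρ-seam : ∀ n c → Admissible n c → Seam true (2 + n) (head (ρ n c))
head-ρ-seam n c (lc , true , o) =
  wrapS c , head-ρ true n c o , trans (length-wrapS c) (cong (2 +_) lc) , oriented-wrap o (stars-wrapS c)
head-ρ-seam n c (lc , false , o) with last-lam n c
... | e , eq , se , le =
  e , trans (head-ρ false n c o) eq , trans le (cong (2 +_) lc) , oriented-flip o se

-- One level later ρ p is read backwards and ρ q forwards, so the chains meeting there are *p* and *q*.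
seam : ∀ n {x y} → Admissible n x → Admissible n y → Smooth n x y →
       Connected (Smooth (2 + n)) (last (ρ n x)) (head (ρ n y))
seam n {x} {y} ax ay (_ , ends) with last-ρ-seam n x ax | head-ρ-seam n y ay
... | p , lp , |p| , op | q , hq , |q| , oq =
  connected-just lp hq (smooth false true op oq pq (just (close-wrapS p q (trans |p| (sym |q|)) pq)))
  where pq = connected-just⁻¹ lp hq ends

invariant : ∀ n → All (Admissible n) (Λ n) × Linked (Smooth n) (Λ n)
invariant 0             = (refl , true , oriented refl) ∷ [] , [-]
invariant 1             = (refl , true , oriented refl) ∷ [] , [-]
invariant (suc (suc n)) with invariant n
... | admissibles , linked =
    All.concat⁺ (All.gmap⁺ (λ {c} a → proj₁ (block n c a)) admissibles)
  , linked-concatMap (ρ n) (λ {c} a → proj₂ (block n c a))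
      (λ {c} a → let e , eq , _ = head-ρ-seam n c a in e , eq) (seam n) admissibles linked

-- The invariant holds for Λ 0 as well.
theorem23 : (n : ℕ) → 1 ≤ n → Linked (λ C D → hamming C D ≤ 3) (Λ n)
theorem23 n _ = Linked.map Smooth.close (proj₂ (invariant n))
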